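{- Let $k\ge 1$ and let ${\sf V}_k={\sf V}\times[k]$ be the chain of V's poset. The order of rowmotion $\rho$ acting on $\mathcal{J}({\sf V}_k)$ is exactly $2(k+2)$.
   Context: ${\sf V}$ is the 3-element poset with elements $c,\ell,r$ and relations $c<\ell$, $c<r$ ($\ell,r$ incomparable). $[k]=\{1<2<\dots<k\}$ is a chain, and ${\sf V}\times[k]$ carries the product order $(x,i)\le(y,j)$ iff $x\le y$ and $i\le j$. For a finite poset $P$, $\mathcal{J}(P)$ is the set of order ideals (down-closed subsets) of $P$. Rowmotion $\rho:\mathcal{J}(P)\to\mathcal{J}(P)$ sends an order ideal $I$ to the order ideal generated by the minimal elements of $P\setminus I$. The order of $\rho$ is the least $N\ge1$ with $\rho^N=\mathrm{id}$. -}

module Defs where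

open import Data.Nat using (ℕ; zero; suc; _≤ᵇ_)
open import Data.Bool using (Bool; true; false; _∧_; _∨_; not)
open import Data.Fin using (Fin; toℕ)
open import Data.List using (List; []; _∷_; map; concatMap)
open import Data.Bool.ListAction using (any; all)
open import Data.List using () renaming (allFin to allFinL)
open import Data.Product using (_×_; _,_; Σ)
open import Relation.Binary.PropositionalEquality using (_≡_)
open import Relation.Nullary using (¬_)
open import Data.Nat using (_≤_; _<_)
open import Data.Nat using (_*_; _+_)

data V : Set where
  c ℓ r : V

_≤V_ : V → V → Bool
c ≤V _ = true
ℓ ≤V ℓ = true
r ≤V r = true
_ ≤V _ = false

allV : List V
allV = c ∷ ℓ ∷ r ∷ []

-- Elements of V × [k]; the chain [k] = {1 < ... < k} is modelled by Fin k
-- (Fin k element i stands for i+1), ordered by toℕ.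
Elt : ℕ → Set
Elt k = V × Fin k

_≤E_ : ∀ {k} → Elt k → Elt k → Bool
(x , i) ≤E (y , j) = (x ≤V y) ∧ (toℕ i ≤ᵇ toℕ j)

_<E_ : ∀ {k} → Elt k → Elt k → Bool
p <E q = (p ≤E q) ∧ not (q ≤E p)

allElts : (k : ℕ) → List (Elt k)
allElts k = concatMap (λ x → map (λ i → (x , i)) (allFinL k)) allV

Subset : ℕ → Set
Subset k = Elt k → Bool

IsIdeal : ∀ {k} → Subset k → Set
IsIdeal {k} S = ∀ (p q : Elt k) → q ≤E p ≡ true → S p ≡ true → S q ≡ true

minCompl : ∀ {k} → Subset k → Elt k → Bool
minCompl {k} S x = not (S x) ∧ all (λ z → not (z <E x) ∨ S z) (allElts k)

rowmotion : ∀ {k} → Subset k → Subset k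
rowmotion {k} S y = any (λ x → minCompl S x ∧ (y ≤E x)) (allElts k)

iter : ∀ {A : Set} → ℕ → (A → A) → A → A
iter zero f a = a
iter (suc n) f a = f (iter n f a)

_≐_ : ∀ {k} → Subset k → Subset k → Set
_≐_ {k} S T = ∀ (p : Elt k) → S p ≡ T p

RowPeriod : ℕ → ℕ → Set
RowPeriod k N = ∀ (I : Subset k) → IsIdeal I → iter N rowmotion I ≐ I

RowOrder : ℕ → ℕ → Set
RowOrder k N =
  (1 ≤ N) × RowPeriod k N ×
  (∀ (M : ℕ) → 1 ≤ M → M < N →
     Σ (Subset k) (λ I → IsIdeal I × ¬ (iter M rowmotion I ≐ I)))

-- An order ideal of V × [k] is determined by the heights a, b, d of its centre column
-- and of its two legs, subject to b, d ≤ a ≤ k. On heights rowmotion lets a leg grow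
-- by one cell if it is below the centre and empties it otherwise, and lets the centre
-- grow if a < k and otherwise sets it to the larger new leg height.
--
-- Start from heights (v, v, q) with q < v, so the left leg is full, and write
-- v = q + l + 1 and k = v + j. After j + 1 steps the centre has climbed to k and
-- dropped again, and we reach (v′, j, v′) with v′ = j + q + 1: the mirror image of a
-- state of the same kind with the parameters (l, q) replaced by (q, j). The triple
-- (j, l, q) is thus rotated, so after three such excursions, of total length
-- (j + 1) + (l + 1) + (q + 1) = k + 2, the legs are swapped; if q = v, two excursions
-- of lengths j + 1 and v + 1 do the same. Every state is reached from one with a full
-- leg and rowmotion commutes with swapping the legs, so ρ^(k+2) swaps the legs of
-- every ideal and ρ^(2(k+2)) = id. No smaller power is the identity: the centre of
-- the empty ideal stays nonempty for k + 1 steps, and ρ^(k+2) moves the ideal with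
-- heights (1, 1, 0).
module Submission where

open import Defs
open import Data.Bool.Base using (Bool; true; false; T; not; _∧_; _∨_; if_then_else_)
open import Data.Bool.ListAction using (and; or)
open import Data.Bool.Properties using (T-∧; T-≡)
open import Data.Fin.Base using (Fin; toℕ; fromℕ<) renaming (zero to fzero; suc to fsuc)
open import Data.Fin.Properties using (toℕ<n; toℕ-fromℕ<)
open import Data.List.Base using (map; allFin)
open import Data.List.Properties using (map-cong)
open import Data.List.Membership.Propositional using (_∈_; lose)
open import Data.List.Membership.Propositional.Properties using (∈-concatMap⁺; ∈-map⁺; ∈-allFin)
open import Data.List.Relation.Unary.Any as Any using (here; there)
open import Data.List.Relation.Unary.Any.Properties using (any⁺; any⁻)
open import Data.List.Relation.Unary.All as All using ()
open import Data.List.Relation.Unary.All.Properties using (all⁺; all⁻)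
open import Data.Nat.Base
open import Data.Nat.Properties
open import Data.Nat.Tactic.RingSolver using (solve-∀)
open import Data.Empty using (⊥-elim)
open import Data.Product using (Σ; ∃; _×_; _,_; proj₁; proj₂)
open import Data.Sum using (_⊎_; inj₁; inj₂)
open import Function.Base using (_∘_)
open import Function.Bundles using (Equivalence)
open import Relation.Binary.PropositionalEquality
open import Relation.Binary.Definitions using (tri<; tri≈; tri>)
open import Relation.Nullary using (¬_; yes; no; contradiction)
open import Relation.Nullary.Reflects using (fromEquivalence; T-reflects-elim)

iter-suc : ∀ {A : Set} (f : A → A) n x → iter (suc n) f x ≡ iter n f (f x)
iter-suc f zero    x = refl
iter-suc f (suc n) x = cong f (iter-suc f n x)

iter-+ : ∀ {A : Set} (f : A → A) m n x → iter (m + n) f x ≡ iter m f (iter n f x)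
iter-+ f zero    n x = refl
iter-+ f (suc m) n x = cong f (iter-+ f m n x)

iter-commute : ∀ {A : Set} (f g : A → A) → (∀ x → f (g x) ≡ g (f x)) →
               ∀ n x → iter n f (g x) ≡ g (iter n f x)
iter-commute f g fg≡gf zero    x = refl
iter-commute f g fg≡gf (suc n) x = trans (cong f (iter-commute f g fg≡gf n x)) (fg≡gf _)

iter-iter-comm : ∀ {A : Set} (f : A → A) m n x → iter m f (iter n f x) ≡ iter n f (iter m f x)
iter-iter-comm f m n = iter-commute f (iter n f) (iter-suc f n) m

-- Rowmotion on column heights

record Heights : Set where
  constructor ⟨_,_,_⟩
  field
    centre left right : ℕ

open Heights

height : Heights → V → ℕ
height h c = centre h
height h ℓ = left h
height h r = right h

Admissible : ℕ → Heights → Set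
Admissible k ⟨ a , b , d ⟩ = b ≤ a × d ≤ a × a ≤ k

mirror : Heights → Heights
mirror ⟨ a , b , d ⟩ = ⟨ a , d , b ⟩

mirror-admissible : ∀ {k} h → Admissible k h → Admissible k (mirror h)
mirror-admissible _ (b≤a , d≤a , a≤k) = d≤a , b≤a , a≤k

legStep : ℕ → ℕ → ℕ
legStep a b with b <? a
... | yes _ = suc b
... | no  _ = 0

ρ : ℕ → Heights → Heights
ρ k ⟨ a , b , d ⟩ with a <? k
... | yes _ = ⟨ suc a , legStep a b , legStep a d ⟩
... | no  _ = ⟨ legStep a b ⊔ legStep a d , legStep a b , legStep a d ⟩

module _ {a b : ℕ} where

  legStep-< : b < a → legStep a b ≡ suc b
  legStep-< b<a with b <? a
  ... | yes _   = refl
  ... | no  b≮a = contradiction b<a b≮a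

  legStep-≥ : a ≤ b → legStep a b ≡ 0
  legStep-≥ a≤b with b <? a
  ... | yes b<a = contradiction a≤b (<⇒≱ b<a)
  ... | no  _   = refl

  legStep-≤ : b ≤ a → legStep a b ≤ a
  legStep-≤ b≤a with b <? a
  ... | yes b<a = b<a
  ... | no  _   = z≤n

  <-legStep⁻ : ∀ {j} → j < legStep a b → b < a × j ≤ b
  <-legStep⁻ j<b′ with b <? a
  ... | yes b<a = b<a , s≤s⁻¹ j<b′

  <-legStep⁺ : ∀ {j} → b < a → j ≤ b → j < legStep a b
  <-legStep⁺ b<a j≤b = subst (_ <_) (sym (legStep-< b<a)) (s≤s j≤b)

module _ {k a b d : ℕ} where

  ρ-below : a < k → ρ k ⟨ a , b , d ⟩ ≡ ⟨ suc a , legStep a b , legStep a d ⟩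
  ρ-below a<k with a <? k
  ... | yes _   = refl
  ... | no  a≮k = contradiction a<k a≮k

  ρ-top : k ≤ a →
          ρ k ⟨ a , b , d ⟩ ≡ ⟨ legStep a b ⊔ legStep a d , legStep a b , legStep a d ⟩
  ρ-top k≤a with a <? k
  ... | yes a<k = contradiction k≤a (<⇒≱ a<k)
  ... | no  _   = refl

  ρ-top-< : k ≤ a → b < a → d < a → ρ k ⟨ a , b , d ⟩ ≡ ⟨ suc b ⊔ suc d , suc b , suc d ⟩
  ρ-top-< k≤a b<a d<a =
    trans (ρ-top k≤a) (cong₂ (λ x y → ⟨ x ⊔ y , x , y ⟩) (legStep-< b<a) (legStep-< d<a))

ρ-mirror : ∀ k h → ρ k (mirror h) ≡ mirror (ρ k h)
ρ-mirror k ⟨ a , b , d ⟩ with a <? k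
... | yes _ = refl
... | no  _ = cong ⟨_, legStep a d , legStep a b ⟩ (⊔-comm (legStep a d) (legStep a b))

iter-ρ-mirror : ∀ k n h → iter n (ρ k) (mirror h) ≡ mirror (iter n (ρ k) h)
iter-ρ-mirror k = iter-commute (ρ k) mirror (ρ-mirror k)

ρ-admissible : ∀ {k} h → Admissible k h → Admissible k (ρ k h)
ρ-admissible {k} ⟨ a , b , d ⟩ (b≤a , d≤a , a≤k) with a <? k
... | yes a<k = m≤n⇒m≤1+n (legStep-≤ b≤a) , m≤n⇒m≤1+n (legStep-≤ d≤a) , a<k
... | no  _   = m≤m⊔n _ _ , m≤n⊔m _ _ ,
                ⊔-lub (≤-trans (legStep-≤ b≤a) a≤k) (≤-trans (legStep-≤ d≤a) a≤k)

iter-ρ-admissible : ∀ {k} n h → Admissible k h → Admissible k (iter n (ρ k) h)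
iter-ρ-admissible zero    h adm = adm
iter-ρ-admissible (suc n) h adm = ρ-admissible _ (iter-ρ-admissible n h adm)

height-antitone : ∀ {k} h {w u} → Admissible k h → T (w ≤V u) → height h u ≤ height h w
height-antitone h {c} {c} _             _ = ≤-refl
height-antitone h {c} {ℓ} (b≤a , _ , _) _ = b≤a
height-antitone h {c} {r} (_ , d≤a , _) _ = d≤a
height-antitone h {ℓ} {ℓ} _             _ = ≤-refl
height-antitone h {r} {r} _             _ = ≤-refl

-- Column u of ideal h can grow by a cell exactly when height h u < ceiling k h u.
ceiling : ℕ → Heights → V → ℕ
ceiling k h c = k
ceiling k h ℓ = centre h
ceiling k h r = centre h

ceiling-≤ : ∀ {k} h u → Admissible k h → ceiling k h u ≤ k
ceiling-≤ h c _             = ≤-refl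
ceiling-≤ h ℓ (_ , _ , a≤k) = a≤k
ceiling-≤ h r (_ , _ , a≤k) = a≤k

ρ-left : ∀ k h → left (ρ k h) ≡ legStep (centre h) (left h)
ρ-left k ⟨ a , b , d ⟩ with a <? k
... | yes _ = refl
... | no  _ = refl

ρ-right : ∀ k h → right (ρ k h) ≡ legStep (centre h) (right h)
ρ-right k h = trans (sym (cong left (ρ-mirror k h))) (ρ-left k (mirror h))

<-ρ-height⁻ : ∀ {k} h w {j} → j < height (ρ k h) w →
              Σ V λ u → T (w ≤V u) × height h u < ceiling k h u × j ≤ height h u
<-ρ-height⁻ {k} h ℓ {j} j< = ℓ , _ , <-legStep⁻ (subst (j <_) (ρ-left k h) j<)
<-ρ-height⁻ {k} h r {j} j< = r , _ , <-legStep⁻ (subst (j <_) (ρ-right k h) j<)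
<-ρ-height⁻ {k} ⟨ a , b , d ⟩ c {j} j< with a <? k
... | yes a<k = c , _ , a<k , s≤s⁻¹ j<
... | no  _ with ⊔-sel (legStep a b) (legStep a d)
...   | inj₁ ⊔≡b = ℓ , _ , <-legStep⁻ (subst (j <_) ⊔≡b j<)
...   | inj₂ ⊔≡d = r , _ , <-legStep⁻ (subst (j <_) ⊔≡d j<)

<-ρ-height⁺ : ∀ {k} h w u {j} → T (w ≤V u) → height h u < ceiling k h u → j ≤ height h u →
              j < height (ρ k h) w
<-ρ-height⁺ {k} h ℓ ℓ {j} _ b<a j≤b = subst (j <_) (sym (ρ-left k h)) (<-legStep⁺ b<a j≤b)
<-ρ-height⁺ {k} h r r {j} _ d<a j≤d = subst (j <_) (sym (ρ-right k h)) (<-legStep⁺ d<a j≤d)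
<-ρ-height⁺ {k} ⟨ a , b , d ⟩ c u _ _ _ with a <? k
<-ρ-height⁺ ⟨ a , b , d ⟩ c c _ _   j≤a | yes _   = s≤s j≤a
<-ρ-height⁺ ⟨ a , b , d ⟩ c ℓ _ b<a j≤b | yes _   = s≤s (≤-trans j≤b (<⇒≤ b<a))
<-ρ-height⁺ ⟨ a , b , d ⟩ c r _ d<a j≤d | yes _   = s≤s (≤-trans j≤d (<⇒≤ d<a))
<-ρ-height⁺ ⟨ a , b , d ⟩ c c _ a<k _   | no  a≮k = contradiction a<k a≮k
<-ρ-height⁺ ⟨ a , b , d ⟩ c ℓ _ b<a j≤b | no  _   = <-≤-trans (<-legStep⁺ b<a j≤b) (m≤m⊔n _ _)
<-ρ-height⁺ ⟨ a , b , d ⟩ c r _ d<a j≤d | no  _   = <-≤-trans (<-legStep⁺ d<a j≤d) (m≤n⊔m _ _)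

-- The period of rowmotion on heights

climb : ∀ {k a b d} → b < a → d < a →
        ∀ n → n + a ≤ k → iter n (ρ k) ⟨ a , b , d ⟩ ≡ ⟨ n + a , n + b , n + d ⟩
climb b<a d<a zero    _ = refl
climb {k} {a} {b} {d} b<a d<a (suc n) n+a<k = begin
  ρ k (iter n (ρ k) ⟨ a , b , d ⟩)  ≡⟨ cong (ρ k) (climb b<a d<a n (<⇒≤ n+a<k)) ⟩
  ρ k ⟨ n + a , n + b , n + d ⟩     ≡⟨ ρ-below n+a<k ⟩
  ⟨ suc (n + a) , legStep (n + a) (n + b) , legStep (n + a) (n + d) ⟩
    ≡⟨ cong₂ ⟨ suc (n + a) ,_,_⟩ (legStep-< (+-monoʳ-< n b<a)) (legStep-< (+-monoʳ-< n d<a)) ⟩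
  ⟨ suc (n + a) , suc (n + b) , suc (n + d) ⟩ ∎
  where open ≡-Reasoning

+-suc-comm : ∀ m n → m + suc n ≡ n + suc m
+-suc-comm = solve-∀

fullLeft-climb : ∀ {k v q} j → q ≤ v → v + suc j ≤ k →
                 iter (suc j) (ρ k) ⟨ v , v , q ⟩ ≡ ⟨ j + suc v , j , j + legStep v q ⟩
fullLeft-climb {k} {v} {q} j q≤v top = begin
  iter (suc j) (ρ k) ⟨ v , v , q ⟩
    ≡⟨ iter-suc (ρ k) j _ ⟩
  iter j (ρ k) (ρ k ⟨ v , v , q ⟩)
    ≡⟨ cong (iter j (ρ k)) (ρ-below (<-≤-trans (m<m+n v z<s) top)) ⟩
  iter j (ρ k) ⟨ suc v , legStep v v , legStep v q ⟩
    ≡⟨ cong (λ x → iter j (ρ k) ⟨ suc v , x , legStep v q ⟩) (legStep-≥ ≤-refl) ⟩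
  iter j (ρ k) ⟨ suc v , 0 , legStep v q ⟩
    ≡⟨ climb z<s (s≤s (legStep-≤ q≤v)) j (≤-trans (≤-reflexive (+-suc-comm j v)) top) ⟩
  ⟨ j + suc v , j + 0 , j + legStep v q ⟩
    ≡⟨ cong (λ x → ⟨ j + suc v , x , j + legStep v q ⟩) (+-identityʳ j) ⟩
  ⟨ j + suc v , j , j + legStep v q ⟩       ∎
  where open ≡-Reasoning

fullLeft-excursion : ∀ {k v q} j → q ≤ v → v + j ≡ k →
                     iter (suc j) (ρ k) ⟨ v , v , q ⟩ ≡ ⟨ j + legStep v q , j , j + legStep v q ⟩
fullLeft-excursion {k} {v} {q} zero q≤v v+0≡k = begin
  ρ k ⟨ v , v , q ⟩                     ≡⟨ ρ-top (≤-reflexive (trans (sym v+0≡k) (+-identityʳ v))) ⟩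
  ⟨ legStep v v ⊔ legStep v q , legStep v v , legStep v q ⟩
    ≡⟨ cong (λ x → ⟨ x ⊔ legStep v q , x , legStep v q ⟩) (legStep-≥ ≤-refl) ⟩
  ⟨ legStep v q , 0 , legStep v q ⟩     ∎
  where open ≡-Reasoning
fullLeft-excursion {k} {v} {q} (suc j) q≤v refl = begin
  ρ k (iter (suc j) (ρ k) ⟨ v , v , q ⟩)         ≡⟨ cong (ρ k) (fullLeft-climb j q≤v ≤-refl) ⟩
  ρ k ⟨ j + suc v , j , j + x ⟩
    ≡⟨ ρ-top-< (≤-reflexive (+-suc-comm v j)) (m<m+n j z<s) (+-monoʳ-< j (s≤s (legStep-≤ q≤v))) ⟩
  ⟨ suc j ⊔ suc (j + x) , suc j , suc (j + x) ⟩
    ≡⟨ cong ⟨_, suc j , suc (j + x) ⟩ (m≤n⇒m⊔n≡n (s≤s (m≤m+n j x))) ⟩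
  ⟨ suc j + x , suc j , suc j + x ⟩              ∎
  where
  open ≡-Reasoning
  x : ℕ
  x = legStep v q

diag : ℕ → Heights
diag v = ⟨ v , v , v ⟩

corner : ℕ → ℕ → Heights
corner l m = ⟨ suc (m + l) , suc (m + l) , m ⟩

diag-excursion : ∀ {k} v j → v + j ≡ k → iter (suc j) (ρ k) (diag v) ≡ diag j
diag-excursion {k} v j v+j≡k = begin
  iter (suc j) (ρ k) (diag v)                ≡⟨ fullLeft-excursion j ≤-refl v+j≡k ⟩
  ⟨ j + legStep v v , j , j + legStep v v ⟩
    ≡⟨ cong (λ x → ⟨ x , j , x ⟩) (trans (cong (j +_) (legStep-≥ ≤-refl)) (+-identityʳ j)) ⟩
  diag j                                     ∎
  where open ≡-Reasoning

corner-excursion : ∀ {k} l m j → suc (m + l) + j ≡ k →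
                   iter (suc j) (ρ k) (corner l m) ≡ mirror (corner m j)
corner-excursion {k} l m j v+j≡k = begin
  iter (suc j) (ρ k) (corner l m)            ≡⟨ fullLeft-excursion j (<⇒≤ m<v) v+j≡k ⟩
  ⟨ j + legStep v m , j , j + legStep v m ⟩
    ≡⟨ cong (λ x → ⟨ x , j , x ⟩) (trans (cong (j +_) (legStep-< m<v)) (+-suc j m)) ⟩
  mirror (corner m j)                        ∎
  where
  open ≡-Reasoning
  v : ℕ
  v = suc (m + l)
  m<v : m < v
  m<v = s≤s (m≤m+n m l)

diag-period : ∀ {k} v j → v + j ≡ k → iter (2 + k) (ρ k) (diag v) ≡ diag v
diag-period {k} v j refl = begin
  iter (2 + (v + j)) (ρ k) (diag v)                 ≡⟨ cong (λ n → iter n (ρ k) (diag v)) (split v j) ⟩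
  iter (suc v + suc j) (ρ k) (diag v)               ≡⟨ iter-+ (ρ k) (suc v) (suc j) (diag v) ⟩
  iter (suc v) (ρ k) (iter (suc j) (ρ k) (diag v))  ≡⟨ cong (iter (suc v) (ρ k)) (diag-excursion v j refl) ⟩
  iter (suc v) (ρ k) (diag j)                       ≡⟨ diag-excursion j v (+-comm j v) ⟩
  diag v                                            ∎
  where
  open ≡-Reasoning
  split : ∀ v j → 2 + (v + j) ≡ suc v + suc j
  split = solve-∀

corner-period : ∀ {k} l m j → suc (m + l + j) ≡ k →
                iter (2 + k) (ρ k) (corner l m) ≡ mirror (corner l m)
corner-period {k} l m j refl = begin
  iter (2 + suc (m + l + j)) (ρ k) (corner l m)
    ≡⟨ cong (λ n → iter n (ρ k) (corner l m)) (split m l j) ⟩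
  iter (suc m + (suc l + suc j)) (ρ k) (corner l m)
    ≡⟨ trans (iter-+ (ρ k) (suc m) _ _) (cong (iter (suc m) (ρ k)) (iter-+ (ρ k) (suc l) (suc j) _)) ⟩
  iter (suc m) (ρ k) (iter (suc l) (ρ k) (iter (suc j) (ρ k) (corner l m)))
    ≡⟨ cong (iter (suc m) (ρ k) ∘ iter (suc l) (ρ k)) (corner-excursion l m j refl) ⟩
  iter (suc m) (ρ k) (iter (suc l) (ρ k) (mirror (corner m j)))
    ≡⟨ cong (iter (suc m) (ρ k)) (iter-ρ-mirror k (suc l) (corner m j)) ⟩
  iter (suc m) (ρ k) (mirror (iter (suc l) (ρ k) (corner m j)))
    ≡⟨ cong (iter (suc m) (ρ k) ∘ mirror) (corner-excursion m j l (cong suc (rotate m l j))) ⟩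
  iter (suc m) (ρ k) (corner j l)
    ≡⟨ corner-excursion j l m (cong suc (trans (rotate j m l) (rotate m l j))) ⟩
  mirror (corner l m)                               ∎
  where
  open ≡-Reasoning
  split : ∀ m l j → 2 + suc (m + l + j) ≡ suc m + (suc l + suc j)
  split = solve-∀
  rotate : ∀ m l j → j + m + l ≡ m + l + j
  rotate = solve-∀

fullLeft-period : ∀ {k a d} → d ≤ a → a ≤ k → iter (2 + k) (ρ k) ⟨ a , a , d ⟩ ≡ ⟨ a , d , a ⟩
fullLeft-period d≤a a≤k with m≤n⇒m<n∨m≡n d≤a | m≤n⇒∃[o]m+o≡n a≤k
... | inj₂ refl | j , a+j≡k = diag-period _ j a+j≡k
... | inj₁ d<a  | j , a+j≡k with m≤n⇒∃[o]m+o≡n d<a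
...   | l , refl = corner-period l _ j a+j≡k

FullLeg : Heights → Set
FullLeg ⟨ a , b , d ⟩ = b ≡ a ⊎ d ≡ a

fullLeg-period : ∀ {k} h → Admissible k h → FullLeg h → iter (2 + k) (ρ k) h ≡ mirror h
fullLeg-period ⟨ a , a , d ⟩ (_ , d≤a , a≤k) (inj₁ refl) = fullLeft-period d≤a a≤k
fullLeg-period {k} ⟨ a , b , a ⟩ (b≤a , _ , a≤k) (inj₂ refl) =
  trans (iter-ρ-mirror k (2 + k) ⟨ a , a , b ⟩) (cong mirror (fullLeft-period b≤a a≤k))

legStep⁻¹ : ℕ → ℕ → ℕ
legStep⁻¹ a zero    = a
legStep⁻¹ a (suc b) = b

legStep⁻¹-≤ : ∀ {a} b → b ≤ a → legStep⁻¹ a b ≤ a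
legStep⁻¹-≤ zero    _   = ≤-refl
legStep⁻¹-≤ (suc b) b<a = <⇒≤ b<a

legStep-legStep⁻¹ : ∀ {a} b → b ≤ a → legStep a (legStep⁻¹ a b) ≡ b
legStep-legStep⁻¹ zero    _   = legStep-≥ ≤-refl
legStep-legStep⁻¹ (suc b) b<a = legStep-< b<a

reached-from-fullLeg : ∀ {k} a b d → Admissible k ⟨ a , b , d ⟩ →
                       Σ ℕ λ n → Σ Heights λ t →
                         Admissible k t × FullLeg t × iter n (ρ k) t ≡ ⟨ a , b , d ⟩
reached-from-fullLeg zero b d adm@(b≤0 , _ , _) = 0 , _ , adm , inj₁ (n≤0⇒n≡0 b≤0) , refl
reached-from-fullLeg {k} (suc a) b d adm@(b≤1+a , d≤1+a , a<k) with b ≤? a | d ≤? a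
... | no b≰a  | _       = 0 , _ , adm , inj₁ (≤-antisym b≤1+a (≰⇒> b≰a)) , refl
... | yes _   | no d≰a  = 0 , _ , adm , inj₂ (≤-antisym d≤1+a (≰⇒> d≰a)) , refl
... | yes b≤a | yes d≤a
  with reached-from-fullLeg a (legStep⁻¹ a b) (legStep⁻¹ a d)
         (legStep⁻¹-≤ b b≤a , legStep⁻¹-≤ d d≤a , <⇒≤ a<k)
...   | n , t , adm-t , full , reaches = suc n , t , adm-t , full , (begin
  ρ k (iter n (ρ k) t)                       ≡⟨ cong (ρ k) reaches ⟩
  ρ k ⟨ a , legStep⁻¹ a b , legStep⁻¹ a d ⟩  ≡⟨ ρ-below a<k ⟩
  ⟨ suc a , legStep a (legStep⁻¹ a b) , legStep a (legStep⁻¹ a d) ⟩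
    ≡⟨ cong₂ ⟨ suc a ,_,_⟩ (legStep-legStep⁻¹ b b≤a) (legStep-legStep⁻¹ d d≤a) ⟩
  ⟨ suc a , b , d ⟩                          ∎)
  where open ≡-Reasoning

ρ-period : ∀ {k} h → Admissible k h → iter (2 + k) (ρ k) h ≡ mirror h
ρ-period {k} h adm with reached-from-fullLeg (centre h) (left h) (right h) adm
... | n , t , adm-t , full , refl = begin
  iter (2 + k) (ρ k) (iter n (ρ k) t)  ≡⟨ iter-iter-comm (ρ k) (2 + k) n t ⟩
  iter n (ρ k) (iter (2 + k) (ρ k) t)  ≡⟨ cong (iter n (ρ k)) (fullLeg-period t adm-t full) ⟩
  iter n (ρ k) (mirror t)              ≡⟨ iter-ρ-mirror k n t ⟩
  mirror (iter n (ρ k) t)              ∎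
  where open ≡-Reasoning

2*[k+2]≡[2+k]+[2+k] : ∀ k → 2 * (k + 2) ≡ (2 + k) + (2 + k)
2*[k+2]≡[2+k]+[2+k] = solve-∀

ρ-double-period : ∀ {k} h → Admissible k h → iter (2 * (k + 2)) (ρ k) h ≡ h
ρ-double-period {k} h adm = begin
  iter (2 * (k + 2)) (ρ k) h                 ≡⟨ cong (λ n → iter n (ρ k) h) (2*[k+2]≡[2+k]+[2+k] k) ⟩
  iter ((2 + k) + (2 + k)) (ρ k) h           ≡⟨ iter-+ (ρ k) (2 + k) (2 + k) h ⟩
  iter (2 + k) (ρ k) (iter (2 + k) (ρ k) h)  ≡⟨ cong (iter (2 + k) (ρ k)) (ρ-period h adm) ⟩
  iter (2 + k) (ρ k) (mirror h)              ≡⟨ ρ-period (mirror h) (mirror-admissible h adm) ⟩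
  h                                          ∎
  where open ≡-Reasoning

iter-empty-nonempty : ∀ {k} n → 0 < k → 0 < n → n < 2 + k → 0 < centre (iter n (ρ k) (diag 0))
iter-empty-nonempty (suc i) 0<k _ 1+i<2+k with m≤n⇒m<n∨m≡n (s≤s⁻¹ (s≤s⁻¹ 1+i<2+k))
... | inj₁ i<k  = subst (λ h → 0 < centre h) (sym (fullLeft-climb i z≤n i<k)) (m≤n+m 1 i)
... | inj₂ refl = subst (λ h → 0 < centre h) (sym (diag-excursion 0 i refl)) 0<k

iter-empty-periodic : ∀ {k} n → iter (2 + k + n) (ρ k) (diag 0) ≡ iter n (ρ k) (diag 0)
iter-empty-periodic {k} n = begin
  iter (2 + k + n) (ρ k) (diag 0)             ≡⟨ iter-+ (ρ k) (2 + k) n (diag 0) ⟩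
  iter (2 + k) (ρ k) (iter n (ρ k) (diag 0))  ≡⟨ iter-iter-comm (ρ k) (2 + k) n (diag 0) ⟩
  iter n (ρ k) (iter (2 + k) (ρ k) (diag 0))
    ≡⟨ cong (iter n (ρ k)) (ρ-period (diag 0) (z≤n , z≤n , z≤n)) ⟩
  iter n (ρ k) (diag 0)                       ∎
  where open ≡-Reasoning

-- Rowmotion as defined on Boolean subsets

T-ext : ∀ {x y} → (T x → T y) → (T y → T x) → x ≡ y
T-ext x⇒y y⇒x = T-reflects-elim (fromEquivalence x⇒y y⇒x)

∈-allElts : ∀ {k} (p : Elt k) → p ∈ allElts k
∈-allElts {k} (u , i) =
  ∈-concatMap⁺ (λ v → map (v ,_) (allFin k)) (lose (∈-allV u) (∈-map⁺ (u ,_) (∈-allFin i)))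
  where
  ∈-allV : ∀ u → u ∈ allV
  ∈-allV c = here refl
  ∈-allV ℓ = there (here refl)
  ∈-allV r = there (there (here refl))

≤V-refl : ∀ u → T (u ≤V u)
≤V-refl c = _
≤V-refl ℓ = _
≤V-refl r = _

≤E-T⁻ : ∀ {k} (p q : Elt k) → T (p ≤E q) →
        T (proj₁ p ≤V proj₁ q) × toℕ (proj₂ p) ≤ toℕ (proj₂ q)
≤E-T⁻ (u , i) (v , j) le with Equivalence.to (T-∧ {u ≤V v}) le
... | u≤v , i≤j = u≤v , ≤ᵇ⇒≤ (toℕ i) (toℕ j) i≤j

≤E-T⁺ : ∀ {k} (p q : Elt k) → T (proj₁ p ≤V proj₁ q) → toℕ (proj₂ p) ≤ toℕ (proj₂ q) →
        T (p ≤E q)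
≤E-T⁺ _ _ u≤v i≤j = Equivalence.from T-∧ (u≤v , ≤⇒≤ᵇ i≤j)

<E-T⁻ : ∀ {k} (p q : Elt k) → T (p <E q) → T (p ≤E q) × ¬ T (q ≤E p)
<E-T⁻ p q lt with q ≤E p
... | false = proj₁ (Equivalence.to T-∧ lt) , λ ()
... | true  = ⊥-elim (proj₂ (Equivalence.to (T-∧ {p ≤E q}) lt))

<E-T⁺ : ∀ {k} (p q : Elt k) → T (p ≤E q) → ¬ T (q ≤E p) → T (p <E q)
<E-T⁺ p q p≤q q≰p with q ≤E p
... | true  = contradiction _ q≰p
... | false = Equivalence.from T-∧ (p≤q , _)

column-<E : ∀ {k} u {i j : Fin k} → toℕ j < toℕ i → T ((u , j) <E (u , i))
column-<E u {i} {j} j<i = <E-T⁺ (u , j) (u , i) (≤E-T⁺ (u , j) (u , i) (≤V-refl u) (<⇒≤ j<i))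
  (λ i≤j → <⇒≱ j<i (proj₂ (≤E-T⁻ (u , i) (u , j) i≤j)))

module _ {k : ℕ} (S : Subset k) where

  minCompl-T⁻ : ∀ x → T (minCompl S x) → ¬ T (S x) × (∀ z → T (z <E x) → T (S z))
  minCompl-T⁻ x m with S x | m
  ... | false | below = (λ ()) , below⇒
    where
    below⇒ : ∀ z → T (z <E x) → T (S z)
    below⇒ z z<x with z <E x | All.lookup (all⁺ _ (allElts k) below) (∈-allElts z)
    ... | true | z∈S = z∈S

  minCompl-T⁺ : ∀ x → ¬ T (S x) → (∀ z → T (z <E x) → T (S z)) → T (minCompl S x)
  minCompl-T⁺ x x∉S below with S x
  ... | true  = contradiction _ x∉S
  ... | false = all⁻ _ (All.tabulate {xs = allElts k} λ {z} _ → below⇒ z)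
    where
    below⇒ : ∀ z → T (not (z <E x) ∨ S z)
    below⇒ z with z <E x in z<x
    ... | true  = below z (subst T (sym z<x) _)
    ... | false = _

  rowmotion-T⁻ : ∀ y → T (rowmotion S y) → ∃ λ x → T (minCompl S x) × T (y ≤E x)
  rowmotion-T⁻ y t with Any.satisfied (any⁻ _ (allElts k) t)
  ... | x , minimal∧above = x , Equivalence.to T-∧ minimal∧above

  rowmotion-T⁺ : ∀ x y → T (minCompl S x) → T (y ≤E x) → T (rowmotion S y)
  rowmotion-T⁺ x y minimal above = any⁺ _ (lose (∈-allElts x) (Equivalence.from T-∧ (minimal , above)))

rowmotion-cong : ∀ {k} {S S′ : Subset k} → S ≐ S′ → rowmotion S ≐ rowmotion S′
rowmotion-cong {k} {S} {S′} S≐S′ y =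
  cong or (map-cong (λ x → cong (_∧ (y ≤E x)) (minCompl-cong x)) (allElts k))
  where
  minCompl-cong : ∀ x → minCompl S x ≡ minCompl S′ x
  minCompl-cong x = cong₂ _∧_ (cong not (S≐S′ x))
    (cong and (map-cong (λ z → cong (not (z <E x) ∨_) (S≐S′ z)) (allElts k)))

iter-rowmotion-cong : ∀ {k} {S S′ : Subset k} → S ≐ S′ →
                      ∀ n → iter n rowmotion S ≐ iter n rowmotion S′
iter-rowmotion-cong S≐S′ zero    = S≐S′
iter-rowmotion-cong S≐S′ (suc n) = rowmotion-cong (iter-rowmotion-cong S≐S′ n)

-- Order ideals as column heights

ideal : ∀ {k} → Heights → Subset k
ideal h (u , i) = toℕ i <ᵇ height h u

ideal-isIdeal : ∀ {k} h → Admissible k h → IsIdeal (ideal {k} h)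
ideal-isIdeal h adm (u , i) (w , j) q≤p p∈I with ≤E-T⁻ (w , j) (u , i) (Equivalence.from T-≡ q≤p)
... | w≤u , j≤i = Equivalence.to T-≡ (<⇒<ᵇ (<-≤-trans
        (≤-<-trans j≤i (<ᵇ⇒< _ _ (Equivalence.from T-≡ p∈I))) (height-antitone h adm w≤u)))

minimal-below-ceiling : ∀ {k} h u {i : Fin k} → T (minCompl (ideal h) (u , i)) → toℕ i < ceiling k h u
minimal-below-ceiling h c {i} _ = toℕ<n i
minimal-below-ceiling h ℓ {i} m = <ᵇ⇒< _ _ (proj₂ (minCompl-T⁻ (ideal h) (ℓ , i) m) (c , i)
  (<E-T⁺ (c , i) (ℓ , i) (≤E-T⁺ (c , i) (ℓ , i) _ ≤-refl) λ ()))
minimal-below-ceiling h r {i} m = <ᵇ⇒< _ _ (proj₂ (minCompl-T⁻ (ideal h) (r , i) m) (c , i)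
  (<E-T⁺ (c , i) (r , i) (≤E-T⁺ (c , i) (r , i) _ ≤-refl) λ ()))

minimal-ideal⁻ : ∀ {k} h u {i : Fin k} → T (minCompl (ideal h) (u , i)) →
                 toℕ i ≡ height h u × height h u < ceiling k h u
minimal-ideal⁻ {k} h u {i} m = i≡H , subst (_< ceiling k h u) i≡H (minimal-below-ceiling h u m)
  where
  outside : ¬ T (ideal h (u , i))
  outside = proj₁ (minCompl-T⁻ (ideal h) (u , i) m)
  i≮H : ¬ height h u < toℕ i
  i≮H H<i = <-irrefl (toℕ-fromℕ< H<k) (<ᵇ⇒< _ _ (proj₂ (minCompl-T⁻ (ideal h) (u , i) m) (u , j)
              (column-<E u (subst (_< toℕ i) (sym (toℕ-fromℕ< H<k)) H<i))))
    where
    H<k : height h u < k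
    H<k = <-trans H<i (toℕ<n i)
    j : Fin k
    j = fromℕ< H<k
  i≡H : toℕ i ≡ height h u
  i≡H = ≤-antisym (≮⇒≥ i≮H) (≮⇒≥ (outside ∘ <⇒<ᵇ))

below-top-cell : ∀ {k} h w u {i j : Fin k} → T (w ≤V u) → toℕ j ≤ toℕ i → ¬ T ((u , i) ≤E (w , j)) →
                 toℕ i ≡ height h u → height h u < ceiling k h u → toℕ j < height h w
below-top-cell h c c {i} {j} _ _   i≰j refl _   = ≰⇒> (i≰j ∘ ≤E-T⁺ (c , i) (c , j) _)
below-top-cell h ℓ ℓ {i} {j} _ _   i≰j refl _   = ≰⇒> (i≰j ∘ ≤E-T⁺ (ℓ , i) (ℓ , j) _)
below-top-cell h r r {i} {j} _ _   i≰j refl _   = ≰⇒> (i≰j ∘ ≤E-T⁺ (r , i) (r , j) _)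
below-top-cell h c ℓ         _ j≤i _   refl b<a = ≤-<-trans j≤i b<a
below-top-cell h c r         _ j≤i _   refl d<a = ≤-<-trans j≤i d<a

minimal-ideal⁺ : ∀ {k} h u {i : Fin k} → toℕ i ≡ height h u → height h u < ceiling k h u →
                 T (minCompl (ideal h) (u , i))
minimal-ideal⁺ h u {i} i≡H H<ceiling =
  minCompl-T⁺ (ideal h) (u , i) (<-irrefl i≡H ∘ <ᵇ⇒< _ _) below
  where
  below : ∀ z → T (z <E (u , i)) → T (ideal h z)
  below (w , j) z<x with <E-T⁻ (w , j) (u , i) z<x
  ... | z≤x , x≰z with ≤E-T⁻ (w , j) (u , i) z≤x
  ...   | w≤u , j≤i = <⇒<ᵇ (below-top-cell h w u w≤u j≤i x≰z i≡H H<ceiling)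

rowmotion-ideal : ∀ {k} h → Admissible k h → rowmotion (ideal {k} h) ≐ ideal (ρ k h)
rowmotion-ideal {k} h adm (w , j) = T-ext to from
  where
  to : T (rowmotion (ideal h) (w , j)) → T (ideal (ρ k h) (w , j))
  to t with rowmotion-T⁻ (ideal h) (w , j) t
  ... | (u , i) , minimal , above with minimal-ideal⁻ h u minimal | ≤E-T⁻ (w , j) (u , i) above
  ...   | i≡H , H<ceiling | w≤u , j≤i =
    <⇒<ᵇ (<-ρ-height⁺ h w u w≤u H<ceiling (subst (toℕ j ≤_) i≡H j≤i))
  from : T (ideal (ρ k h) (w , j)) → T (rowmotion (ideal h) (w , j))
  from t with <-ρ-height⁻ h w (<ᵇ⇒< _ _ t)
  ... | u , w≤u , H<ceiling , j≤H =
    rowmotion-T⁺ (ideal h) (u , i) (w , j) (minimal-ideal⁺ h u i≡H H<ceiling)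
      (≤E-T⁺ (w , j) (u , i) w≤u (subst (toℕ j ≤_) (sym i≡H) j≤H))
    where
    H<k : height h u < k
    H<k = <-≤-trans H<ceiling (ceiling-≤ h u adm)
    i : Fin k
    i = fromℕ< H<k
    i≡H : toℕ i ≡ height h u
    i≡H = toℕ-fromℕ< H<k

iter-rowmotion-ideal : ∀ {k} h → Admissible k h → ∀ n →
                       iter n rowmotion (ideal {k} h) ≐ ideal (iter n (ρ k) h)
iter-rowmotion-ideal h adm zero    _ = refl
iter-rowmotion-ideal h adm (suc n) p = trans (rowmotion-cong (iter-rowmotion-ideal h adm n) p)
                                             (rowmotion-ideal _ (iter-ρ-admissible n h adm) p)

prefixLength : ∀ {k} → (Fin k → Bool) → ℕ
prefixLength {zero}  f = 0
prefixLength {suc k} f = if f fzero then suc (prefixLength (f ∘ fsuc)) else 0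

prefixLength-≤ : ∀ {k} (f : Fin k → Bool) → prefixLength f ≤ k
prefixLength-≤ {zero}  f = z≤n
prefixLength-≤ {suc k} f with f fzero
... | true  = s≤s (prefixLength-≤ (f ∘ fsuc))
... | false = z≤n

downClosed-prefix : ∀ {k} (f : Fin k → Bool) → (∀ {i j} → toℕ i ≤ toℕ j → T (f j) → T (f i)) →
                    ∀ i → f i ≡ (toℕ i <ᵇ prefixLength f)
downClosed-prefix {suc k} f down i with f fzero in f0≡
downClosed-prefix {suc k} f down fzero    | true  = f0≡
downClosed-prefix {suc k} f down (fsuc i) | true  = downClosed-prefix (f ∘ fsuc) (down ∘ s≤s) i
downClosed-prefix {suc k} f down i        | false = T-ext (λ fi → subst T f0≡ (down z≤n fi)) λ ()

columnHeight : ∀ {k} → Subset k → V → ℕ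
columnHeight I u = prefixLength (λ i → I (u , i))

heightsOf : ∀ {k} → Subset k → Heights
heightsOf I = ⟨ columnHeight I c , columnHeight I ℓ , columnHeight I r ⟩

module _ {k} {I : Subset k} (isIdeal : IsIdeal I) where

  isIdeal-T : ∀ p q → T (q ≤E p) → T (I p) → T (I q)
  isIdeal-T p q q≤p p∈I =
    Equivalence.from T-≡ (isIdeal p q (Equivalence.to T-≡ q≤p) (Equivalence.to T-≡ p∈I))

  column-prefix : ∀ u i → I (u , i) ≡ (toℕ i <ᵇ columnHeight I u)
  column-prefix u = downClosed-prefix (λ i → I (u , i))
    λ {i} {j} i≤j → isIdeal-T (u , j) (u , i) (≤E-T⁺ (u , i) (u , j) (≤V-refl u) i≤j)

  ideal-heightsOf : I ≐ ideal (heightsOf I)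
  ideal-heightsOf (c , i) = column-prefix c i
  ideal-heightsOf (ℓ , i) = column-prefix ℓ i
  ideal-heightsOf (r , i) = column-prefix r i

  leg≤centre : ∀ u → columnHeight I u ≤ columnHeight I c
  leg≤centre u = ≮⇒≥ centre≮leg
    where
    centre≮leg : ¬ columnHeight I c < columnHeight I u
    centre≮leg centre<leg = <-irrefl i≡centre (<ᵇ⇒< _ _ (subst T (column-prefix c i) i∈centre))
      where
      centre<k : columnHeight I c < k
      centre<k = <-≤-trans centre<leg (prefixLength-≤ _)
      i : Fin k
      i = fromℕ< centre<k
      i≡centre : toℕ i ≡ columnHeight I c
      i≡centre = toℕ-fromℕ< centre<k
      i∈leg : T (I (u , i))
      i∈leg = subst T (sym (column-prefix u i))
                (<⇒<ᵇ (subst (_< columnHeight I u) (sym i≡centre) centre<leg))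
      i∈centre : T (I (c , i))
      i∈centre = isIdeal-T (u , i) (c , i) (≤E-T⁺ (c , i) (u , i) _ ≤-refl) i∈leg

  heightsOf-admissible : Admissible k (heightsOf I)
  heightsOf-admissible = leg≤centre ℓ , leg≤centre r , prefixLength-≤ _

-- The order of rowmotion

rowmotion-period : ∀ k → RowPeriod k (2 * (k + 2))
rowmotion-period k I isIdeal p = begin
  iter N rowmotion I p          ≡⟨ iter-rowmotion-cong (ideal-heightsOf isIdeal) N p ⟩
  iter N rowmotion (ideal h) p  ≡⟨ iter-rowmotion-ideal h adm N p ⟩
  ideal (iter N (ρ k) h) p      ≡⟨ cong (λ h′ → ideal h′ p) (ρ-double-period h adm) ⟩
  ideal h p                     ≡⟨ ideal-heightsOf isIdeal p ⟨
  I p                           ∎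
  where
  open ≡-Reasoning
  N : ℕ
  N = 2 * (k + 2)
  h : Heights
  h = heightsOf I
  adm : Admissible k h
  adm = heightsOf-admissible isIdeal

moved⇒not-fixed : ∀ {k} h n → Admissible k h → ∀ p → ideal (iter n (ρ k) h) p ≢ ideal h p →
                  ¬ (iter n rowmotion (ideal {k} h) ≐ ideal h)
moved⇒not-fixed h n adm p moved fixed = moved (trans (sym (iter-rowmotion-ideal h adm n p)) (fixed p))

empty-ideal-moved : ∀ {k} n → 0 < centre (iter n (ρ (suc k)) (diag 0)) →
                    Σ (Subset (suc k)) λ I → IsIdeal I × ¬ (iter n rowmotion I ≐ I)
empty-ideal-moved n 0<centre =
  ideal (diag 0) , ideal-isIdeal _ adm ,
  moved⇒not-fixed _ n adm (c , fzero) λ moved → subst T moved (<⇒<ᵇ 0<centre)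
  where
  adm : Admissible _ (diag 0)
  adm = z≤n , z≤n , z≤n

swapped-ideal-moved : ∀ k → Σ (Subset (suc k)) λ I → IsIdeal I × ¬ (iter (2 + suc k) rowmotion I ≐ I)
swapped-ideal-moved k =
  ideal (corner 0 0) , ideal-isIdeal _ adm , moved⇒not-fixed _ (2 + suc k) adm (ℓ , fzero) swapped
  where
  adm : Admissible (suc k) (corner 0 0)
  adm = s≤s z≤n , z≤n , s≤s z≤n
  swapped : ideal {suc k} (iter (2 + suc k) (ρ (suc k)) (corner 0 0)) (ℓ , fzero) ≢
            ideal {suc k} (corner 0 0) (ℓ , fzero)
  swapped moved =
    contradiction (trans (cong (λ h → ideal {suc k} h (ℓ , fzero)) (sym (ρ-period (corner 0 0) adm))) moved) λ ()

rowmotion-no-smaller-period : ∀ k M → 0 < M → M < 2 * (suc k + 2) →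
                              Σ (Subset (suc k)) λ I → IsIdeal I × ¬ (iter M rowmotion I ≐ I)
rowmotion-no-smaller-period k M 0<M M<N with <-cmp M (2 + suc k)
... | tri< M<K _ _  = empty-ideal-moved M (iter-empty-nonempty M z<s 0<M M<K)
... | tri≈ _ refl _ = swapped-ideal-moved k
... | tri> _ _ K<M with m≤n⇒∃[o]m+o≡n (<⇒≤ K<M)
...   | o , refl =
  empty-ideal-moved M
    (subst (0 <_) (cong centre (sym (iter-empty-periodic o))) (iter-empty-nonempty o z<s 0<o o<K))
  where
  0<o : 0 < o
  0<o = +-cancelˡ-< (2 + suc k) 0 o (subst (_< M) (sym (+-identityʳ _)) K<M)
  o<K : o < 2 + suc k
  o<K = +-cancelˡ-< (2 + suc k) o _ (subst (M <_) (2*[k+2]≡[2+k]+[2+k] (suc k)) M<N)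

theorem3p2 : ∀ (k : ℕ) → 1 ≤ k → RowOrder k (2 * (k + 2))
theorem3p2 (suc k) _ = s≤s z≤n , rowmotion-period (suc k) , rowmotion-no-smaller-period k
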